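{- Let $G=(V,E)$ be a graph, let $K$ be a closed critical clique in $G$, and let $\Psi:E\to 2^{\{1,\dots,c\}}$ for some $c\in\mathbb{N}$. Let $v\in\mathcal{N}(K)$ and let $E'\subseteq E(\{v\},K)$ be such that all edges in $E'$ have the same list under $\Psi$. Then there is an optimal STC-labeling $L=(S^1_L,\dots,S^c_L,W_L)$ for $G$ and $\Psi$ such that $E'\subseteq A$ for some $A\in\{S^1_L,\dots,S^c_L,W_L\}$.
   Context: A $c$-labeling of $G=(V,E)$ is a partition $L=(S^1_L,\dots,S^c_L,W_L)$ of $E$ (strong classes $S^i_L$, weak class $W_L$); it is an STC-labeling if there are no edges $\{u,v\},\{v,w\}$ in a common $S^i_L$ with $\{u,w\}\notin E$. $L$ is $\Psi$-satisfying if each edge $e$ lies in $W_L$ or in $S^\alpha_L$ for some $\alpha\in\Psi(e)$. A $c$-colored STC-labeling is optimal for $G$ and $\Psi$ if it is $\Psi$-satisfying and $|W_L|$ is minimum among all $\Psi$-satisfying $c$-colored STC-labelings. For vertex sets $V_1,V_2$, $E(V_1,V_2)$ is the set of edges with one endpoint in $V_1$ and the other in $V_2$. A critical clique of $G$ is a clique $K$ whose vertices all have the same neighbors in $V\setminus K$, maximal with this property. The critical clique graph has the critical cliques as vertices, with $K_i,K_j$ adjacent iff every vertex of $K_i$ is adjacent to every vertex of $K_j$. $\mathcal{N}(K)$ is the union of the critical cliques adjacent to $K$ in the critical clique graph. $K$ is closed if $\mathcal{N}(K)$ is a clique in $G$. -}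

module Defs where

open import Data.Nat using (ℕ; _≤_; _<_)
open import Data.Bool using (Bool; true; false; if_then_else_)
open import Data.Fin using (Fin; toℕ)
open import Data.Fin.Subset using (Subset; _∈_; _∉_; _⊆_)
open import Data.Maybe using (Maybe; just; nothing)
open import Data.List using (List; allFin; filter; length; concatMap; map)
open import Data.Product using (Σ; _×_; _,_; ∃)
open import Data.Sum using (_⊎_)
open import Relation.Nullary using (¬_; Dec; yes; no)
open import Relation.Nullary.Decidable using (_×-dec_)
open import Relation.Binary.PropositionalEquality using (_≡_; _≢_)
open import Data.Nat.Properties using (_<?_)
open import Data.Bool.Properties using () renaming (_≟_ to _≟ᵇ_)

record Graph (n : ℕ) : Set where
  field
    adj   : Fin n → Fin n → Bool
    sym   : ∀ u v → adj u v ≡ adj v u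
    irrefl : ∀ u → adj u u ≡ false

open Graph public

Edge : ∀ {n} → Graph n → Fin n → Fin n → Set
Edge G u v = adj G u v ≡ true

-- A list function Ψ : E → 2^{1..c}, given on ordered pairs, required symmetric on edges.
ListFn : ℕ → ℕ → Set
ListFn n c = Fin n → Fin n → Subset c

ListFnOn : ∀ {n c} → Graph n → ListFn n c → Set
ListFnOn G Ψ = ∀ u v → Edge G u v → Ψ u v ≡ Ψ v u

-- A c-labeling: each edge gets a label, just i (strong class S^i) or nothing (weak class W).
-- Given on ordered pairs; it must be symmetric on edges (values on non-edges are irrelevant).
Labeling : ℕ → ℕ → Set
Labeling n c = Fin n → Fin n → Maybe (Fin c)

IsLabeling : ∀ {n c} → Graph n → Labeling n c → Set
IsLabeling G L = ∀ u v → Edge G u v → L u v ≡ L v u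

IsSTC : ∀ {n c} → Graph n → Labeling n c → Set
IsSTC G L = ∀ u v w i → u ≢ w → Edge G u v → Edge G v w →
  L u v ≡ just i → L v w ≡ just i → Edge G u w

PsiSatisfying : ∀ {n c} → Graph n → ListFn n c → Labeling n c → Set
PsiSatisfying G Ψ L = ∀ u v → Edge G u v →
  (L u v ≡ nothing) ⊎ (Σ (Fin _) λ α → (L u v ≡ just α) × (α ∈ Ψ u v))

isNothing? : ∀ {c} (m : Maybe (Fin c)) → Dec (m ≡ nothing)
isNothing? nothing = yes _≡_.refl
isNothing? (just _) = no (λ ())

-- |W_L|: number of edges {u,v} (counted once, with toℕ u < toℕ v) labeled weak.
weakCount : ∀ {n c} → Graph n → Labeling n c → ℕ
weakCount {n} G L =
  length (filter (λ p → (toℕ (Data.Product.proj₁ p) <? toℕ (Data.Product.proj₂ p))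
                          ×-dec (adj G (Data.Product.proj₁ p) (Data.Product.proj₂ p) ≟ᵇ true)
                          ×-dec isNothing? (L (Data.Product.proj₁ p) (Data.Product.proj₂ p)))
                 (concatMap (λ u → map (λ v → (u , v)) (allFin n)) (allFin n)))

IsPsiSTC : ∀ {n c} → Graph n → ListFn n c → Labeling n c → Set
IsPsiSTC G Ψ L = IsLabeling G L × IsSTC G L × PsiSatisfying G Ψ L

Optimal : ∀ {n c} → Graph n → ListFn n c → Labeling n c → Set
Optimal G Ψ L = IsPsiSTC G Ψ L ×
  (∀ L' → IsPsiSTC G Ψ L' → weakCount G L ≤ weakCount G L')

IsClique : ∀ {n} → Graph n → Subset n → Set
IsClique G K = ∀ u v → u ∈ K → v ∈ K → u ≢ v → Edge G u v

SameNbhd : ∀ {n} → Graph n → Subset n → Set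
SameNbhd G K = ∀ x y z → x ∈ K → y ∈ K → z ∉ K → adj G x z ≡ adj G y z

IsCriticalCliqueCandidate : ∀ {n} → Graph n → Subset n → Set
IsCriticalCliqueCandidate G K = IsClique G K × SameNbhd G K

IsCriticalClique : ∀ {n} → Graph n → Subset n → Set
IsCriticalClique G K = IsCriticalCliqueCandidate G K ×
  (∀ K' → IsCriticalCliqueCandidate G K' → K ⊆ K' → K' ⊆ K)

CCAdjacent : ∀ {n} → Graph n → Subset n → Subset n → Set
CCAdjacent G K K' = K ≢ K' × (∀ x y → x ∈ K → y ∈ K' → Edge G x y)

InN : ∀ {n} → Graph n → Subset n → Fin n → Set
InN G K v = Σ (Subset _) λ K' → IsCriticalClique G K' × CCAdjacent G K K' × v ∈ K'

Closed : ∀ {n} → Graph n → Subset n → Set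
Closed G K = ∀ u w → InN G K u → InN G K w → u ≢ w → Edge G u w

-- Start from any optimal labeling L (one exists: there are finitely many labelings). If all
-- edges vx, x ∈ X, are weak we are done. Otherwise some vx₀ has a strong colour i, and we give
-- every edge vx, x ∈ X, the colour i. This is Ψ-satisfying because the lists agree, it has no
-- more weak edges, and it is still an STC-labeling: the vertices of X are true twins of x₀, so
-- a violation at a vertex of X reduces to one of L at x₀, while closedness of K makes v adjacent
-- to every other neighbour w of K (the true-twin class of w is a critical clique adjacent to K).

module Submission where

open import Defs hiding (sym)
open import Data.Nat using (ℕ; zero; suc; _≤_)
open import Data.Nat.Properties using (≤-trans)
open import Data.Bool using (true)
open import Data.Bool.Properties using () renaming (_≟_ to _≟ᵇ_)
open import Data.Fin as Fin using (Fin)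
open import Data.Fin.Properties using (all?; any?) renaming (_≟_ to _≟ᶠ_)
open import Data.Fin.Subset using (Subset; _∈_; _∉_; _⊆_; _∪_; ⁅_⁆)
open import Data.Fin.Subset.Properties using (_∈?_; x∈p∪q⁺; x∈p∪q⁻; x∈⁅x⁆; x∈⁅y⁆⇒x≡y)
open import Data.Maybe using (Maybe; just; nothing)
open import Data.Maybe.Properties using (≡-dec; just-injective)
open import Data.Product using (Σ; _×_; _,_; proj₁; proj₂)
open import Data.Sum using (_⊎_; inj₁; inj₂; map₂)
open import Data.Empty using (⊥-elim)
open import Data.List using (List; []; _∷_; map; concatMap; filter; length; allFin)
open import Data.List.Relation.Unary.Any as Any using (Any; here; there)
open import Data.List.Relation.Unary.Any.Properties using (map⁺; concatMap⁺)
open import Data.List.Relation.Unary.All.Properties using (all-filter)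
open import Data.List.Membership.Propositional using (find) renaming (_∈_ to _∈ₗ_)
open import Data.List.Membership.Propositional.Properties using (∈-filter⁺; ∈-allFin)
open import Data.List.Extrema.Nat using (argmin; argmin-all; f[argmin]≤f[xs])
import Data.List.Relation.Unary.All as All
open import Data.List.Relation.Binary.Sublist.Propositional using (⊆-refl)
open import Data.List.Relation.Binary.Sublist.Heterogeneous.Properties using (⊆-filter-Sublist; length-mono-≤)
open import Data.Vec.Functional using (Vector) renaming ([] to []ᵛ; _∷_ to _∷ᵛ_)
open import Data.Vec.Functional.Relation.Binary.Pointwise using (Pointwise)
open import Data.Vec using (tabulate)
open import Data.Vec.Properties using (lookup∘tabulate; []=⇒lookup; lookup⇒[]=)
open import Relation.Nullary using (¬_; Dec; yes; no; does)
open import Relation.Nullary.Decidable using (¬?; _×-dec_; _⊎-dec_; _→-dec_; dec-true)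
open import Relation.Unary using (Pred; Decidable)
open import Relation.Binary.PropositionalEquality using (_≡_; _≢_; refl; sym; trans; cong; subst)

-- Exhaustive search over labelings

Exhaustive : ∀ {a r} {A : Set a} → (A → A → Set r) → List A → Set _
Exhaustive R xs = ∀ y → Any (λ x → R x y) xs

vectors : ∀ {a} {A : Set a} (m : ℕ) → List A → List (Vector A m)
vectors zero    xs = []ᵛ ∷ []
vectors (suc m) xs = concatMap (λ x → map (x ∷ᵛ_) (vectors m xs)) xs

vectors-exhaustive : ∀ {a r} {A : Set a} {R : A → A → Set r} {xs : List A} →
  Exhaustive R xs → ∀ m → Exhaustive (Pointwise R) (vectors m xs)
vectors-exhaustive xs-ex zero    f = here λ ()
vectors-exhaustive xs-ex (suc m) f =
  concatMap⁺ _ (Any.map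
    (λ R-head → map⁺ (Any.map
      (λ R-tail → λ { Fin.zero → R-head ; (Fin.suc i) → R-tail i })
      (vectors-exhaustive xs-ex m (λ i → f (Fin.suc i)))))
    (xs-ex (f Fin.zero)))

maybes : ∀ c → List (Maybe (Fin c))
maybes c = nothing ∷ map just (allFin c)

maybes-exhaustive : ∀ c → Exhaustive _≡_ (maybes c)
maybes-exhaustive c nothing  = here refl
maybes-exhaustive c (just i) = there (map⁺ (Any.map (λ i≡j → cong just (sym i≡j)) (∈-allFin i)))

labelings : ∀ n c → List (Labeling n c)
labelings n c = vectors n (vectors n (maybes c))

labelings-exhaustive : ∀ {n c} → Exhaustive (λ L L′ → ∀ a b → L a b ≡ L′ a b) (labelings n c)
labelings-exhaustive {n} {c} = vectors-exhaustive (vectors-exhaustive (maybes-exhaustive c) n) n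

-- Labelings and their weak edges

edge? : ∀ {n} (G : Graph n) u v → Dec (Edge G u v)
edge? G u v = adj G u v ≟ᵇ true

edge-sym : ∀ {n} (G : Graph n) {u v} → Edge G u v → Edge G v u
edge-sym G {u} {v} e = trans (sym (Graph.sym G u v)) e

isPsiSTC? : ∀ {n c} (G : Graph n) (Ψ : ListFn n c) → Decidable (IsPsiSTC G Ψ)
isPsiSTC? G Ψ L = isLabeling? ×-dec (isSTC? ×-dec psiSatisfying?)
  where
  _≟ᵐ_ = ≡-dec _≟ᶠ_
  isLabeling? = all? λ u → all? λ v → edge? G u v →-dec (L u v ≟ᵐ L v u)
  isSTC? = all? λ u → all? λ v → all? λ w → all? λ i → ¬? (u ≟ᶠ w) →-dec (edge? G u v →-dec
             (edge? G v w →-dec ((L u v ≟ᵐ just i) →-dec ((L v w ≟ᵐ just i) →-dec edge? G u w))))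
  psiSatisfying? = all? λ u → all? λ v → edge? G u v →-dec ((L u v ≟ᵐ nothing) ⊎-dec
             any? (λ α → (L u v ≟ᵐ just α) ×-dec (α ∈? Ψ u v)))

isPsiSTC-resp : ∀ {n c} (G : Graph n) (Ψ : ListFn n c) {L L′ : Labeling n c} →
  (∀ a b → L a b ≡ L′ a b) → IsPsiSTC G Ψ L′ → IsPsiSTC G Ψ L
isPsiSTC-resp G Ψ {L} {L′} L≗L′ (isLabeling , isSTC , psiSatisfying) =
  (λ u v e → trans (L≗L′ u v) (trans (isLabeling u v e) (sym (L≗L′ v u)))) ,
  (λ u v w i u≢w e₁ e₂ p q → isSTC u v w i u≢w e₁ e₂ (trans (sym (L≗L′ u v)) p) (trans (sym (L≗L′ v w)) q)) ,
  psiSatisfying′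
  where
  psiSatisfying′ : PsiSatisfying G Ψ L
  psiSatisfying′ u v e with psiSatisfying u v e
  ... | inj₁ weak           = inj₁ (trans (L≗L′ u v) weak)
  ... | inj₂ (α , strong , α∈Ψ) = inj₂ (α , trans (L≗L′ u v) strong , α∈Ψ)

allWeak : ∀ {n c} → Labeling n c
allWeak _ _ = nothing

allWeak-isPsiSTC : ∀ {n c} (G : Graph n) (Ψ : ListFn n c) → IsPsiSTC G Ψ allWeak
allWeak-isPsiSTC G Ψ = (λ _ _ _ → refl) , (λ { _ _ _ _ _ _ _ () _ }) , (λ _ _ _ → inj₁ refl)

length-filter-mono : ∀ {a p q} {A : Set a} {P : Pred A p} {Q : Pred A q} (P? : Decidable P) (Q? : Decidable Q) →
  (∀ {x} → P x → Q x) → ∀ xs → length (filter P? xs) ≤ length (filter Q? xs)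
length-filter-mono P? Q? P⇒Q xs = length-mono-≤ (⊆-filter-Sublist P? Q? (λ { refl → P⇒Q }) (⊆-refl {x = xs}))

weakCount-mono : ∀ {n c} (G : Graph n) {L L′ : Labeling n c} →
  (∀ a b → L a b ≡ nothing → L′ a b ≡ nothing) → weakCount G L ≤ weakCount G L′
weakCount-mono {n} G weak⇒weak′ =
  length-filter-mono _ _ (λ (u<v , e , weak) → u<v , e , weak⇒weak′ _ _ weak)
    (concatMap (λ u → map (λ v → (u , v)) (allFin n)) (allFin n))

-- Opaque because unfolding the argmin makes with-abstractions over optimal-exists very slow.
opaque
  optimal-exists : ∀ {n c} (G : Graph n) (Ψ : ListFn n c) → Σ (Labeling n c) (Optimal G Ψ)
  optimal-exists {n} {c} G Ψ = L* , L*-isPsiSTC , L*-minimal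
    where
    candidates : List (Labeling n c)
    candidates = filter (isPsiSTC? G Ψ) (labelings n c)

    L* : Labeling n c
    L* = argmin (weakCount G) allWeak candidates

    L*-isPsiSTC : IsPsiSTC G Ψ L*
    L*-isPsiSTC = argmin-all (weakCount G) (allWeak-isPsiSTC G Ψ) (all-filter (isPsiSTC? G Ψ) (labelings n c))

    L*-minimal : ∀ L → IsPsiSTC G Ψ L → weakCount G L* ≤ weakCount G L
    L*-minimal L L-ok =
      let L′ , L′∈ , L′≗L = find (labelings-exhaustive L) in
      ≤-trans (L*-below (∈-filter⁺ (isPsiSTC? G Ψ) L′∈ (isPsiSTC-resp G Ψ L′≗L L-ok)))
              (weakCount-mono G (λ a b weak → trans (sym (L′≗L a b)) weak))
      where
      L*-below : ∀ {L′} → L′ ∈ₗ candidates → weakCount G L* ≤ weakCount G L′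
      L*-below = All.lookup (f[argmin]≤f[xs] {f = weakCount G} allWeak candidates)

optimal-if-fewer-weak : ∀ {n c} {G : Graph n} {Ψ : ListFn n c} {L L′ : Labeling n c} →
  Optimal G Ψ L → IsPsiSTC G Ψ L′ → (∀ a b → L′ a b ≡ nothing → L a b ≡ nothing) → Optimal G Ψ L′
optimal-if-fewer-weak {G = G} (_ , L-minimal) L′-ok weak′⇒weak =
  L′-ok , λ L″ L″-ok → ≤-trans (weakCount-mono G weak′⇒weak) (L-minimal L″ L″-ok)

-- Critical cliques

subset : ∀ {n p} {P : Pred (Fin n) p} → Decidable P → Subset n
subset P? = tabulate (λ y → does (P? y))

∈-subset⁺ : ∀ {n p} {P : Pred (Fin n) p} (P? : Decidable P) {y} → P y → y ∈ subset P?
∈-subset⁺ P? {y} py = lookup⇒[]= y (subset P?) (trans (lookup∘tabulate _ y) (dec-true (P? y) py))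

∈-subset⁻ : ∀ {n p} {P : Pred (Fin n) p} (P? : Decidable P) {y} → y ∈ subset P? → P y
∈-subset⁻ P? {y} y∈ with P? y | trans (sym (lookup∘tabulate (λ y → does (P? y)) y)) ([]=⇒lookup y∈)
... | yes py | _ = py
... | no _   | ()

TrueTwin : ∀ {n} → Graph n → Fin n → Fin n → Set
TrueTwin G y w = (y ≡ w ⊎ Edge G y w) × (∀ z → y ≢ z → w ≢ z → adj G y z ≡ adj G w z)

trueTwin? : ∀ {n} (G : Graph n) w → Decidable (λ y → TrueTwin G y w)
trueTwin? G w y = ((y ≟ᶠ w) ⊎-dec edge? G y w) ×-dec
  all? (λ z → ¬? (y ≟ᶠ z) →-dec (¬? (w ≟ᶠ z) →-dec (adj G y z ≟ᵇ adj G w z)))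

twins : ∀ {n} → Graph n → Fin n → Subset n
twins G w = subset (trueTwin? G w)

distinct-twins-adjacent : ∀ {n} (G : Graph n) {y w} → y ≢ w → TrueTwin G y w → Edge G y w
distinct-twins-adjacent G y≢w (inj₁ y≡w , _) = ⊥-elim (y≢w y≡w)
distinct-twins-adjacent G y≢w (inj₂ y~w , _) = y~w

module _ {n} (G : Graph n) (w : Fin n) where

  private
    twin : ∀ {y} → y ∈ twins G w → TrueTwin G y w
    twin = ∈-subset⁻ (trueTwin? G w)

  w∈twins[w] : w ∈ twins G w
  w∈twins[w] = ∈-subset⁺ (trueTwin? G w) (inj₁ refl , λ _ _ _ → refl)

  twins-isClique : IsClique G (twins G w)
  twins-isClique y y′ y∈ y′∈ y≢y′ with w ≟ᶠ y′ | proj₁ (twin y∈) | proj₁ (twin y′∈)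
  ... | yes refl | inj₁ y≡w  | _         = ⊥-elim (y≢y′ y≡w)
  ... | yes refl | inj₂ y~w  | _         = y~w
  ... | no w≢y′  | _         | inj₁ y′≡w = ⊥-elim (w≢y′ (sym y′≡w))
  ... | no w≢y′  | _         | inj₂ y′~w = trans (proj₂ (twin y∈) y′ y≢y′ w≢y′) (edge-sym G y′~w)

  twins-sameNbhd : SameNbhd G (twins G w)
  twins-sameNbhd x y z x∈ y∈ z∉ =
    trans (proj₂ (twin x∈) z (λ { refl → z∉ x∈ }) w≢z) (sym (proj₂ (twin y∈) z (λ { refl → z∉ y∈ }) w≢z))
    where
    w≢z : w ≢ z
    w≢z refl = z∉ w∈twins[w]

  twins-maximal : ∀ K′ → IsCriticalCliqueCandidate G K′ → twins G w ⊆ K′ → K′ ⊆ twins G w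
  twins-maximal K′ (clique′ , same′) twins⊆K′ {y} y∈K′ = ∈-subset⁺ (trueTwin? G w) (adjacent , sameOutside)
    where
    w∈K′ = twins⊆K′ w∈twins[w]
    adjacent : y ≡ w ⊎ Edge G y w
    adjacent with y ≟ᶠ w
    ... | yes y≡w = inj₁ y≡w
    ... | no y≢w  = inj₂ (clique′ y w y∈K′ w∈K′ y≢w)
    sameOutside : ∀ z → y ≢ z → w ≢ z → adj G y z ≡ adj G w z
    sameOutside z y≢z w≢z with z ∈? K′
    ... | yes z∈K′ = trans (clique′ y z y∈K′ z∈K′ y≢z) (sym (clique′ w z w∈K′ z∈K′ w≢z))
    ... | no z∉K′  = same′ y w z y∈K′ w∈K′ z∉K′

  twins-isCritical : IsCriticalClique G (twins G w)
  twins-isCritical = (twins-isClique , twins-sameNbhd) , twins-maximal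

∈-critical-twin : ∀ {n} (G : Graph n) {K : Subset n} → IsCriticalClique G K →
  ∀ {b w} → b ∈ K → TrueTwin G b w → w ∈ K
∈-critical-twin G {K} ((clique , same) , maximal) {b} {w} b∈K b~w with w ∈? K
... | yes w∈K = w∈K
... | no w∉K  = maximal (K ∪ ⁅ w ⁆) (clique⁺ , same⁺) (λ x∈K → x∈p∪q⁺ (inj₁ x∈K)) w∈K⁺
  where
  w∈K⁺ : w ∈ K ∪ ⁅ w ⁆
  w∈K⁺ = x∈p∪q⁺ (inj₂ (x∈⁅x⁆ w))

  member : ∀ {x} → x ∈ K ∪ ⁅ w ⁆ → x ∈ K ⊎ x ≡ w
  member x∈ = map₂ (x∈⁅y⁆⇒x≡y w) (x∈p∪q⁻ K ⁅ w ⁆ x∈)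

  K~w : ∀ x → x ∈ K → Edge G x w
  K~w x x∈K = trans (same x b w x∈K b∈K w∉K) (distinct-twins-adjacent G (λ { refl → w∉K b∈K }) b~w)

  clique⁺ : IsClique G (K ∪ ⁅ w ⁆)
  clique⁺ x y x∈ y∈ x≢y with member x∈ | member y∈
  ... | inj₁ x∈K | inj₁ y∈K = clique x y x∈K y∈K x≢y
  ... | inj₁ x∈K | inj₂ refl = K~w x x∈K
  ... | inj₂ refl | inj₁ y∈K = edge-sym G (K~w y y∈K)
  ... | inj₂ refl | inj₂ refl = ⊥-elim (x≢y refl)

  same⁺ : SameNbhd G (K ∪ ⁅ w ⁆)
  same⁺ x y z x∈ y∈ z∉ = trans (like-b x∈) (sym (like-b y∈))
    where
    z∉K : z ∉ K
    z∉K z∈K = z∉ (x∈p∪q⁺ (inj₁ z∈K))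
    like-b : ∀ {x} → x ∈ K ∪ ⁅ w ⁆ → adj G x z ≡ adj G b z
    like-b {x} x∈ with member x∈
    ... | inj₁ x∈K = same x b z x∈K b∈K z∉K
    ... | inj₂ refl = sym (proj₂ b~w z (λ { refl → z∉K b∈K }) (λ { refl → z∉ w∈K⁺ }))

neighbour∈𝒩 : ∀ {n} (G : Graph n) {K : Subset n} → IsCriticalClique G K →
  ∀ {m w} → m ∈ K → Edge G m w → w ∉ K → InN G K w
neighbour∈𝒩 G {K} K-critical {m} {w} m∈K m~w w∉K =
  twins G w , twins-isCritical G w , (K≢twins , K~twins) , w∈twins[w] G w
  where
  K≢twins : K ≢ twins G w
  K≢twins K≡twins = w∉K (subst (w ∈_) (sym K≡twins) (w∈twins[w] G w))

  K~twins : ∀ a b → a ∈ K → b ∈ twins G w → Edge G a b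
  K~twins a b a∈K b∈ = edge-sym G (trans (proj₂ b~w a b≢a w≢a) (edge-sym G a~w))
    where
    b~w = ∈-subset⁻ (trueTwin? G w) b∈
    a~w : Edge G a w
    a~w = trans (proj₂ (proj₁ K-critical) a m w a∈K m∈K w∉K) m~w
    b≢a : b ≢ a
    b≢a refl = w∉K (∈-critical-twin G K-critical a∈K b~w)
    w≢a : w ≢ a
    w≢a refl = w∉K a∈K

-- Recolouring the edges between v and X

module _ {n} {M : Fin n → Fin n → Set} (M? : ∀ a b → Dec (M a b)) where

  override : ∀ {c} → Maybe (Fin c) → Labeling n c → Labeling n c
  override A L a b with M? a b
  ... | yes _ = A
  ... | no _  = L a b

  override-inside : ∀ {c} {A : Maybe (Fin c)} {L a b} → M a b → override A L a b ≡ A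
  override-inside {a = a} {b} m with M? a b
  ... | yes _ = refl
  ... | no ¬m = ⊥-elim (¬m m)

  override-outside : ∀ {c} {A : Maybe (Fin c)} {L a b} → ¬ M a b → override A L a b ≡ L a b
  override-outside {a = a} {b} ¬m with M? a b
  ... | yes m = ⊥-elim (¬m m)
  ... | no _  = refl

  override-isLabeling : ∀ {c} {G : Graph n} {A : Maybe (Fin c)} {L} → (∀ {a b} → M a b → M b a) →
    IsLabeling G L → IsLabeling G (override A L)
  override-isLabeling M-sym L-isLabeling a b e with M? a b
  ... | yes m = sym (override-inside (M-sym m))
  ... | no ¬m = trans (L-isLabeling a b e) (sym (override-outside (λ m → ¬m (M-sym m))))

  override-psiSatisfying : ∀ {c} {G : Graph n} {Ψ : ListFn n c} {i L} →
    (∀ {a b} → M a b → Edge G a b → i ∈ Ψ a b) →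
    PsiSatisfying G Ψ L → PsiSatisfying G Ψ (override (just i) L)
  override-psiSatisfying {i = i} i∈Ψ L-psiSatisfying a b e with M? a b | L-psiSatisfying a b e
  ... | yes m | _ = inj₂ (i , refl , i∈Ψ m e)
  ... | no _  | L-ok = L-ok

  override-weak : ∀ {c} {i : Fin c} {L a b} → override (just i) L a b ≡ nothing → L a b ≡ nothing
  override-weak {a = a} {b} weak with M? a b
  ... | no _ = weak

Spoke : ∀ {n} → Fin n → Subset n → Fin n → Fin n → Set
Spoke v X a b = (a ≡ v × b ∈ X) ⊎ (b ≡ v × a ∈ X)

spoke? : ∀ {n} v (X : Subset n) a b → Dec (Spoke v X a b)
spoke? v X a b = ((a ≟ᶠ v) ×-dec (b ∈? X)) ⊎-dec ((b ≟ᶠ v) ×-dec (a ∈? X))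

spoke-sym : ∀ {n} {v} {X : Subset n} {a b} → Spoke v X a b → Spoke v X b a
spoke-sym (inj₁ s) = inj₂ s
spoke-sym (inj₂ s) = inj₁ s

strong∈Ψ : ∀ {n c} {G : Graph n} {Ψ : ListFn n c} {L : Labeling n c} → PsiSatisfying G Ψ L →
  ∀ {a b i} → Edge G a b → L a b ≡ just i → i ∈ Ψ a b
strong∈Ψ L-psiSatisfying {a} {b} e L[a,b]≡i with L-psiSatisfying a b e
... | inj₂ (α , L[a,b]≡α , α∈Ψ) = subst (_∈ _) (just-injective (trans (sym L[a,b]≡α) L[a,b]≡i)) α∈Ψ
... | inj₁ weak with trans (sym L[a,b]≡i) weak
...   | ()

𝒩-adjacent : ∀ {n} (G : Graph n) {K : Subset n} {v} → InN G K v → ∀ {x} → x ∈ K → Edge G x v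
𝒩-adjacent G (_ , _ , (_ , K~K′) , v∈K′) x∈K = K~K′ _ _ x∈K v∈K′

𝒩-closed-adjacent : ∀ {n} (G : Graph n) {K : Subset n} {v} → IsCriticalClique G K → Closed G K → InN G K v →
  ∀ {m w} → m ∈ K → Edge G m w → w ≢ v → Edge G v w
𝒩-closed-adjacent G {K} {v} K-critical K-closed v∈𝒩 {m} {w} m∈K m~w w≢v with w ∈? K
... | yes w∈K = edge-sym G (𝒩-adjacent G v∈𝒩 w∈K)
... | no w∉K  = K-closed v w v∈𝒩 (neighbour∈𝒩 G K-critical m∈K m~w w∉K) (λ v≡w → w≢v (sym v≡w))

module _ {n c} (G : Graph n) {K : Subset n} (K-critical : IsCriticalClique G K) (K-closed : Closed G K)
  {v : Fin n} (v∈𝒩 : InN G K v) {X : Subset n} (X⊆K : X ⊆ K)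
  {L : Labeling n c} {x₀ : Fin n} {i : Fin c} (x₀∈X : x₀ ∈ X) (L[v,x₀]≡i : L v x₀ ≡ just i) where

  private
    L′ : Labeling n c
    L′ = override (spoke? v X) (just i) L

    clique = proj₁ (proj₁ K-critical)
    same = proj₂ (proj₁ K-critical)

    X~v : ∀ {x} → x ∈ X → Edge G x v
    X~v x∈X = 𝒩-adjacent G v∈𝒩 (X⊆K x∈X)

    L′-isLabeling : IsLabeling G L → IsLabeling G L′
    L′-isLabeling = override-isLabeling (spoke? v X) {G = G} {A = just i} spoke-sym

    v∉X : v ∉ X
    v∉X v∈X with trans (sym (Graph.irrefl G v)) (X~v v∈X)
    ... | ()

  spokes-override-isSTC : IsLabeling G L → IsSTC G L → IsSTC G L′
  spokes-override-isSTC L-isLabeling L-isSTC = isSTC′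
    where
    -- Outside K, u has the neighbours of x₀, and x₀ w is an edge by the STC property of L at v.
    strong-at-v : ∀ {u w} → u ∈ X → u ≢ w → Edge G v w → L′ v w ≡ just i → Edge G u w
    strong-at-v {u} {w} u∈X u≢w v~w L′[v,w]≡i with w ∈? K
    ... | yes w∈K = clique u w (X⊆K u∈X) w∈K u≢w
    ... | no w∉K  = trans (same u x₀ w (X⊆K u∈X) (X⊆K x₀∈X) w∉K) x₀~w
      where
      not-spoke : ¬ Spoke v X v w
      not-spoke (inj₁ (_ , w∈X)) = w∉K (X⊆K w∈X)
      not-spoke (inj₂ (_ , v∈X)) = v∉X v∈X
      L[v,w]≡i : L v w ≡ just i
      L[v,w]≡i = trans (sym (override-outside (spoke? v X) not-spoke)) L′[v,w]≡i
      x₀~w : Edge G x₀ w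
      x₀~w = L-isSTC x₀ v w i (λ { refl → w∉K (X⊆K x₀∈X) }) (X~v x₀∈X) v~w
               (trans (L-isLabeling x₀ v (X~v x₀∈X)) L[v,x₀]≡i) L[v,w]≡i

    isSTC′ : IsSTC G L′
    isSTC′ u m w j u≢w u~m m~w p q with spoke? v X u m
    ... | yes (inj₁ (refl , m∈X)) =
      𝒩-closed-adjacent G K-critical K-closed v∈𝒩 (X⊆K m∈X) m~w (λ w≡v → u≢w (sym w≡v))
    ... | yes (inj₂ (refl , u∈X)) = strong-at-v u∈X u≢w m~w (trans q (sym p))
    ... | no ¬spoke[u,m] with spoke? v X m w
    ...   | yes (inj₁ (refl , w∈X)) =
      edge-sym G (strong-at-v w∈X (λ w≡u → u≢w (sym w≡u)) (edge-sym G u~m) L′[v,u]≡i)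
      where
      L′[v,u]≡i : L′ v u ≡ just i
      L′[v,u]≡i = trans (L′-isLabeling L-isLabeling v u (edge-sym G u~m))
                    (trans (override-outside (spoke? v X) ¬spoke[u,m]) (trans p (sym q)))
    ...   | yes (inj₂ (refl , m∈X)) =
      edge-sym G (𝒩-closed-adjacent G K-critical K-closed v∈𝒩 (X⊆K m∈X) (edge-sym G u~m) u≢w)
    ...   | no _ = L-isSTC u m w j u≢w u~m m~w p q

  spokes-override-optimal : ∀ {Ψ : ListFn n c} → ListFnOn G Ψ → (∀ x y → x ∈ X → y ∈ X → Ψ v x ≡ Ψ v y) →
    Optimal G Ψ L → Optimal G Ψ L′
  spokes-override-optimal {Ψ} Ψ-sym same-list L-optimal@((L-isLabeling , L-isSTC , L-psiSatisfying) , _) =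
    optimal-if-fewer-weak {G = G} L-optimal
      ( L′-isLabeling L-isLabeling
      , spokes-override-isSTC L-isLabeling L-isSTC
      , override-psiSatisfying (spoke? v X) {G = G} i∈Ψ L-psiSatisfying )
      (λ a b → override-weak (spoke? v X) {L = L} {a} {b})
    where
    i∈Ψ[v,x₀] : i ∈ Ψ v x₀
    i∈Ψ[v,x₀] = strong∈Ψ {G = G} L-psiSatisfying (edge-sym G (X~v x₀∈X)) L[v,x₀]≡i

    i∈Ψ : ∀ {a b} → Spoke v X a b → Edge G a b → i ∈ Ψ a b
    i∈Ψ (inj₁ (refl , b∈X)) _   = subst (i ∈_) (same-list x₀ _ x₀∈X b∈X) i∈Ψ[v,x₀]
    i∈Ψ (inj₂ (refl , a∈X)) a~v =
      subst (i ∈_) (trans (same-list x₀ _ x₀∈X a∈X) (Ψ-sym v _ (edge-sym G a~v))) i∈Ψ[v,x₀]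

strong? : ∀ {c} (m : Maybe (Fin c)) → Dec (Σ (Fin c) λ i → m ≡ just i)
strong? nothing  = no λ ()
strong? (just i) = yes (i , refl)

not-strong⇒weak : ∀ {c} (m : Maybe (Fin c)) → ¬ (Σ (Fin c) λ i → m ≡ just i) → m ≡ nothing
not-strong⇒weak nothing  _       = refl
not-strong⇒weak (just i) ¬strong = ⊥-elim (¬strong (i , refl))

lemma5 : ∀ {n} (G : Graph n) (K : Subset n) → IsCriticalClique G K → Closed G K →
    (c : ℕ) (Ψ : ListFn n c) → ListFnOn G Ψ →
    (v : Fin n) → InN G K v →
    (X : Subset n) → X ⊆ K →
    (∀ x y → x ∈ X → y ∈ X → Ψ v x ≡ Ψ v y) →
    Σ (Labeling n c) λ L → Optimal G Ψ L ×
      Σ (Maybe (Fin c)) λ A → ∀ x → x ∈ X → L v x ≡ A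
lemma5 G K K-critical K-closed c Ψ Ψ-sym v v∈𝒩 X X⊆K same-list with optimal-exists G Ψ
... | L , L-optimal with any? (λ x → (x ∈? X) ×-dec strong? (L v x))
...   | yes (x₀ , x₀∈X , i , L[v,x₀]≡i) =
  override (spoke? v X) (just i) L ,
  spokes-override-optimal G K-critical K-closed v∈𝒩 X⊆K x₀∈X L[v,x₀]≡i Ψ-sym same-list L-optimal ,
  just i , λ x x∈X → override-inside (spoke? v X) (inj₁ (refl , x∈X))
...   | no ¬strong =
  L , L-optimal , nothing , λ x x∈X → not-strong⇒weak (L v x) (λ (i , L[v,x]≡i) → ¬strong (x , x∈X , i , L[v,x]≡i))
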